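{- Let $r\ge 0$ and let $\phi:B_r\to B_r+\phi(0)$ be a graph isomorphism onto a subgraph of $\Gamma$. Then for every vertex $x\in V(B_r)$ we have $\rho(\phi(x)-\phi(0))=\rho(x)$ and $\omega(\phi(x)-\phi(0))=\omega(x)$.
   Context: Let $G$ be a free abelian group of finite rank $k\ge1$, identified with $\mathbb{Z}^k$, and $\mathcal{A}\subset G$ a finite generating set with $\mathcal{A}=-\mathcal{A}$, $0\notin\mathcal{A}$. $\Gamma=\mathrm{Cay}(G,\mathcal{A})$ has vertex set $G$ and edges $\{x,x+a\}$, $a\in\mathcal{A}$. For $x\in G$, $\rho(x)$ is the length of a shortest path in $\Gamma$ from $0$ to $x$, and $\omega(x)$ is the number of shortest paths in $\Gamma$ from $0$ to $x$. $B_r$ is the subgraph of $\Gamma$ induced by $\{x:\rho(x)\le r\}$, and $B_r+z$ is its translate by $z\in G$. -}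

module Defs where

open import Data.Nat using (ℕ; zero; suc; _≤_)
open import Data.Integer using (ℤ; 0ℤ) renaming (_+_ to _+ℤ_; -_ to -ℤ_)
open import Data.Vec using (Vec; zipWith; replicate; map)
open import Data.List using (List; foldr)
open import Data.List.Membership.Propositional using (_∈_; _∉_)
open import Data.List.Relation.Unary.All using (All)
open import Data.List.Relation.Unary.Unique.Propositional using (Unique)
open import Data.Fin using (Fin)
open import Data.Product using (Σ; ∃; _×_)
open import Function.Bundles using (_↔_)
open import Relation.Binary.PropositionalEquality using (_≡_)

Vertex : ℕ → Set
Vertex k = Vec ℤ k

0v : ∀ {k} → Vertex k
0v = replicate _ 0ℤ

infixl 6 _⊕_ _⊖_
_⊕_ : ∀ {k} → Vertex k → Vertex k → Vertex k
_⊕_ = zipWith _+ℤ_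

neg : ∀ {k} → Vertex k → Vertex k
neg = map -ℤ_

_⊖_ : ∀ {k} → Vertex k → Vertex k → Vertex k
x ⊖ y = x ⊕ neg y

vsum : ∀ {k} → List (Vertex k) → Vertex k
vsum = foldr _⊕_ 0v

record GenSet (k : ℕ) : Set where
  field
    gens       : List (Vertex k)
    unique     : Unique gens
    symmetric  : ∀ {a} → a ∈ gens → neg a ∈ gens
    zero∉      : 0v ∉ gens
    -- 𝒜 generates G (as 𝒜 = -𝒜, every element is a finite sum of elements of 𝒜)
    generating : ∀ (x : Vertex k) → Σ (List (Vertex k)) (λ w → All (_∈ gens) w × vsum w ≡ x)

module _ {k : ℕ} (𝒜 : GenSet k) where
  open GenSet 𝒜

  Adj : Vertex k → Vertex k → Set
  Adj x y = (y ⊖ x) ∈ gens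

  data Path : Vertex k → Vertex k → ℕ → Set where
    []   : ∀ {x} → Path x x 0
    _∷_  : ∀ {x y z n} → Adj x y → Path y z n → Path x z (suc n)

  ρ≡ : Vertex k → ℕ → Set
  ρ≡ x n = Path 0v x n × (∀ m → Path 0v x m → n ≤ m)

  ω≡ : Vertex k → ℕ → Set
  ω≡ x m = Σ ℕ (λ n → ρ≡ x n × (Fin m ↔ Path 0v x n))

  InBall : ℕ → Vertex k → Set
  InBall r x = Σ ℕ (λ n → ρ≡ x n × n ≤ r)

  -- φ is a graph isomorphism from B_r (induced subgraph of Γ) onto B_r + φ(0).
  -- φ is given as a function on G; only its values on V(B_r) matter.
  record IsBallIso (r : ℕ) (φ : Vertex k → Vertex k) : Set where
    field
      maps-into  : ∀ {x} → InBall r x → InBall r (φ x ⊖ φ 0v)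
      injective  : ∀ {x y} → InBall r x → InBall r y → φ x ≡ φ y → x ≡ y
      surjective : ∀ {y} → InBall r (y ⊖ φ 0v) → ∃ λ x → InBall r x × φ x ≡ y
      adj-pres   : ∀ {x y} → InBall r x → InBall r y → Adj x y → Adj (φ x) (φ y)
      adj-refl   : ∀ {x y} → InBall r x → InBall r y → Adj (φ x) (φ y) → Adj x y

-- Write ψ(x) = φ(x) - φ(0).  Since adjacency in a Cayley graph is invariant
-- under translation, ψ is an isomorphism of the induced subgraph B_r onto
-- itself with ψ(0) = 0.  The key observation is that a path of length m ≤ r
-- starting at 0 never leaves B_r: its i-th vertex has distance at most i
-- (ρ exists by the least-number principle, path existence being decidable).
-- Hence ψ transports such paths vertex by vertex, and the preimages of the
-- vertices (surjectivity) give the inverse transport; two paths with the same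
-- start and the same vertex sequence coincide, because membership proofs in
-- the duplicate-free list of generators are unique.  This yields, for x ∈ B_r
-- and m ≤ r, a bijection  Path 0 x m ↔ Path 0 ψ(x) m,  from which both claims
-- follow: geodesics of length ρ(x) ≤ r correspond, and a shorter path to ψ(x)
-- would pull back to a shorter path to x.
module Submission where

open import Defs
open import Data.Nat using (ℕ; zero; suc; _+_; _≤_; _<_; _≤?_)
open import Data.Nat.Properties
  using (≤-trans; ≮⇒≥; ≰⇒>; <⇒≤; +-suc; +-identityʳ; m≤m+n; m<1+n⇒m<n∨m≡n)
open import Data.Product using (Σ; ∃; _×_; _,_)
open import Data.Sum using (inj₁; inj₂)
open import Data.Integer as ℤ using () renaming (_+_ to _+ℤ_; -_ to -ℤ_)
open import Data.Integer.Properties using (+-comm; +-inverseʳ)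
open import Data.Integer.Tactic.RingSolver using (solve-∀)
open import Data.Vec as Vec using ()
open import Data.Vec.Properties using (≡-dec; zipWith-comm; zipWith-inverseʳ)
open import Data.List as List using (List)
open import Data.List.Properties using (∷-injective)
open import Data.List.Membership.Propositional using (_∈_; lose; find)
open import Data.List.Membership.Propositional.Properties.WithK using (unique⇒irrelevant)
open import Data.List.Relation.Unary.Any using (any?)
open import Data.List.Relation.Unary.All using (All; []; _∷_)
open import Function.Bundles using (_↔_; mk↔ₛ′; module Inverse)
open import Function.Construct.Composition using (_↔-∘_)
open import Relation.Nullary using (Dec; yes; no; ¬_; contradiction)
open import Relation.Binary.PropositionalEquality

module LeastNumber {P : ℕ → Set} (P? : ∀ n → Dec (P n)) where

  Least : Set
  Least = Σ ℕ λ n → P n × (∀ j → P j → n ≤ j)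

  search : ∀ d b → (∀ j → j < b → ¬ P j) → P (d + b) → Least
  search d b below _ with P? b
  ... | yes pb = b , pb , λ j pj → ≮⇒≥ λ j<b → below j j<b pj
  search zero    b below pb  | no ¬pb = contradiction pb ¬pb
  search (suc d) b below pdb | no ¬pb =
    search d (suc b) below′ (subst P (sym (+-suc d b)) pdb)
    where
    below′ : ∀ j → j < suc b → ¬ P j
    below′ j j<1+b with m<1+n⇒m<n∨m≡n j<1+b
    ... | inj₁ j<b  = below j j<b
    ... | inj₂ refl = ¬pb

  least : ∀ {m} → P m → Least
  least {m} pm = search m 0 (λ _ ()) (subst P (sym (+-identityʳ m)) pm)

⊕-comm : ∀ {k} (a b : Vertex k) → a ⊕ b ≡ b ⊕ a
⊕-comm = zipWith-comm +-comm

⊖-self : ∀ {k} (a : Vertex k) → a ⊖ a ≡ 0v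
⊖-self = zipWith-inverseʳ +-inverseʳ

⊕-⊖-cancel : ∀ {k} (a c : Vertex k) → (a ⊕ c) ⊖ c ≡ a
⊕-⊖-cancel Vec.[] Vec.[] = refl
⊕-⊖-cancel (a Vec.∷ as) (c Vec.∷ cs) = cong₂ Vec._∷_ (law a c) (⊕-⊖-cancel as cs)
  where law : ∀ a c → (a +ℤ c) +ℤ -ℤ c ≡ a
        law = solve-∀

⊖-⊕-cancel : ∀ {k} (a c : Vertex k) → (a ⊖ c) ⊕ c ≡ a
⊖-⊕-cancel Vec.[] Vec.[] = refl
⊖-⊕-cancel (a Vec.∷ as) (c Vec.∷ cs) = cong₂ Vec._∷_ (law a c) (⊖-⊕-cancel as cs)
  where law : ∀ a c → (a +ℤ -ℤ c) +ℤ c ≡ a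
        law = solve-∀

⊖-translate : ∀ {k} (b a c : Vertex k) → (b ⊖ c) ⊖ (a ⊖ c) ≡ b ⊖ a
⊖-translate Vec.[] Vec.[] Vec.[] = refl
⊖-translate (b Vec.∷ bs) (a Vec.∷ as) (c Vec.∷ cs) =
  cong₂ Vec._∷_ (law b a c) (⊖-translate bs as cs)
  where law : ∀ b a c → (b +ℤ -ℤ c) +ℤ -ℤ (a +ℤ -ℤ c) ≡ b +ℤ -ℤ a
        law = solve-∀

⊖-cancelʳ : ∀ {k} {a b : Vertex k} c → a ⊖ c ≡ b ⊖ c → a ≡ b
⊖-cancelʳ {a = a} {b} c eq = begin
  a             ≡⟨ sym (⊖-⊕-cancel a c) ⟩
  (a ⊖ c) ⊕ c   ≡⟨ cong (_⊕ c) eq ⟩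
  (b ⊖ c) ⊕ c   ≡⟨ ⊖-⊕-cancel b c ⟩
  b             ∎
  where open ≡-Reasoning

⊕-difference : ∀ {k} (a c : Vertex k) → a ⊕ (c ⊖ a) ≡ c
⊕-difference a c = trans (⊕-comm a (c ⊖ a)) (⊖-⊕-cancel c a)

difference-⊕ : ∀ {k} (a g : Vertex k) → (a ⊕ g) ⊖ a ≡ g
difference-⊕ a g = trans (cong (_⊖ a) (⊕-comm a g)) (⊕-⊖-cancel g a)

_≟v_ : ∀ {k} (a b : Vertex k) → Dec (a ≡ b)
_≟v_ = ≡-dec ℤ._≟_

map-injectiveOn : ∀ {A B : Set} {P : A → Set} {f : A → B}
  → (∀ {x y} → P x → P y → f x ≡ f y → x ≡ y)
  → ∀ {xs ys} → All P xs → All P ys → List.map f xs ≡ List.map f ys → xs ≡ ys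
map-injectiveOn inj [] [] _ = refl
map-injectiveOn inj (px ∷ pxs) (py ∷ pys) eq with ∷-injective eq
... | fx≡fy , rest = cong₂ List._∷_ (inj px py fx≡fy) (map-injectiveOn inj pxs pys rest)

module Cayley {k : ℕ} (𝒜 : GenSet k) where
  open GenSet 𝒜

  -- Membership proofs in the duplicate-free list of generators are unique,
  -- so an edge is determined by its endpoints.
  adj-irrelevant : ∀ {a b} (e e′ : Adj 𝒜 a b) → e ≡ e′
  adj-irrelevant = unique⇒irrelevant unique

  adj-translate : ∀ {a b} c → Adj 𝒜 a b → Adj 𝒜 (a ⊖ c) (b ⊖ c)
  adj-translate {a} {b} c = subst (_∈ gens) (sym (⊖-translate b a c))

  adj-untranslate : ∀ {a b} c → Adj 𝒜 (a ⊖ c) (b ⊖ c) → Adj 𝒜 a b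
  adj-untranslate {a} {b} c = subst (_∈ gens) (⊖-translate b a c)

  snoc : ∀ {a b c n} → Path 𝒜 a b n → Adj 𝒜 b c → Path 𝒜 a c (suc n)
  snoc []      e = e ∷ []
  snoc (d ∷ p) e = d ∷ snoc p e

  trace : ∀ {a b n} → Path 𝒜 a b n → List (Vertex k)
  trace []                = List.[]
  trace (_∷_ {y = c} _ p) = c List.∷ trace p

  trace-injective : ∀ {a b n} (p q : Path 𝒜 a b n) → trace p ≡ trace q → p ≡ q
  trace-injective []      []       _  = refl
  trace-injective (e ∷ p) (e′ ∷ q) eq with ∷-injective eq
  ... | refl , rest = cong₂ _∷_ (adj-irrelevant e e′) (trace-injective p q rest)

  trace-subst : ∀ {a b b′ n} (eq : b ≡ b′) (p : Path 𝒜 a b n)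
    → trace (subst (λ z → Path 𝒜 a z n) eq p) ≡ trace p
  trace-subst refl p = refl

  path? : ∀ n a b → Dec (Path 𝒜 a b n)
  path? zero a b with a ≟v b
  ... | yes refl = yes []
  ... | no a≢b   = no λ { [] → a≢b refl }
  path? (suc n) a b with any? (λ g → path? n (a ⊕ g) b) gens
  ... | yes found =
    let g , g∈ , p = find found in yes (subst (_∈ gens) (sym (difference-⊕ a g)) g∈ ∷ p)
  ... | no none = no λ { (_∷_ {y = c} e p) →
    none (lose e (subst (λ z → Path 𝒜 z b n) (sym (⊕-difference a c)) p)) }

  ρ-exists : ∀ {y m} → Path 𝒜 0v y m → Σ ℕ λ n → ρ≡ 𝒜 y n × n ≤ m
  ρ-exists {y} p with least p
    where open LeastNumber (λ j → path? j 0v y)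
  ... | n , pn , minimal = n , (pn , minimal) , minimal _ p

module InsideBall {k : ℕ} (𝒜 : GenSet k) (r : ℕ) where
  open Cayley 𝒜

  -- a is reached from 0 in i steps with i + j ≤ r: every walk of length j
  -- from a stays inside B_r.
  Within : ℕ → Vertex k → Set
  Within j a = Σ ℕ λ i → Path 𝒜 0v a i × i + j ≤ r

  within-origin : ∀ {j} → j ≤ r → Within j 0v
  within-origin j≤r = 0 , [] , j≤r

  within-ball : ∀ {j a} → Within j a → InBall 𝒜 r a
  within-ball {j} (i , p , i+j≤r) with ρ-exists p
  ... | n , ρa , n≤i = n , ρa , ≤-trans n≤i (≤-trans (m≤m+n i j) i+j≤r)

  within-step : ∀ {j a b} → Within (suc j) a → Adj 𝒜 a b → Within j b
  within-step {j} (i , p , le) e = suc i , snoc p e , subst (_≤ r) (+-suc i j) le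

  within-trace : ∀ {j a b} → Within j a → (p : Path 𝒜 a b j) → All (InBall 𝒜 r) (trace p)
  within-trace w []      = []
  within-trace w (e ∷ p) = within-ball (within-step w e) ∷ within-trace (within-step w e) p

module Transport {k : ℕ} (𝒜 : GenSet k) (r : ℕ) (φ : Vertex k → Vertex k)
                 (iso : IsBallIso 𝒜 r φ) where
  open Cayley 𝒜
  open InsideBall 𝒜 r
  open IsBallIso iso

  Ball : Vertex k → Set
  Ball = InBall 𝒜 r

  ψ : Vertex k → Vertex k
  ψ x = φ x ⊖ φ 0v

  ψ-zero : ψ 0v ≡ 0v
  ψ-zero = ⊖-self (φ 0v)

  ψ-injective : ∀ {a b} → Ball a → Ball b → ψ a ≡ ψ b → a ≡ b
  ψ-injective ba bb eq = injective ba bb (⊖-cancelʳ (φ 0v) eq)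

  ψ-surjective : ∀ {y} → Ball y → ∃ λ x → Ball x × ψ x ≡ y
  ψ-surjective {y} by with surjective (subst Ball (sym (⊕-⊖-cancel y (φ 0v))) by)
  ... | x , bx , φx≡ = x , bx , trans (cong (_⊖ φ 0v) φx≡) (⊕-⊖-cancel y (φ 0v))

  ψ-adj : ∀ {a b} → Ball a → Ball b → Adj 𝒜 a b → Adj 𝒜 (ψ a) (ψ b)
  ψ-adj ba bb e = adj-translate (φ 0v) (adj-pres ba bb e)

  ψ-adj⁻¹ : ∀ {a b} → Ball a → Ball b → Adj 𝒜 (ψ a) (ψ b) → Adj 𝒜 a b
  ψ-adj⁻¹ ba bb e = adj-refl ba bb (adj-untranslate (φ 0v) e)

  push : ∀ {m a b} → Within m a → Path 𝒜 a b m → Path 𝒜 (ψ a) (ψ b) m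
  push w []      = []
  push w (e ∷ p) = ψ-adj (within-ball w) (within-ball w′) e ∷ push w′ p
    where w′ = within-step w e

  push-trace : ∀ {m a b} (w : Within m a) (p : Path 𝒜 a b m)
    → trace (push w p) ≡ List.map ψ (trace p)
  push-trace w []      = refl
  push-trace w (e ∷ p) = cong (_ List.∷_) (push-trace (within-step w e) p)

  record Lift {c d m} (a : Vertex k) (q : Path 𝒜 c d m) : Set where
    field
      end         : Vertex k
      path        : Path 𝒜 a end m
      end-ball    : Ball end
      end-image   : ψ end ≡ d
      trace-ball  : All Ball (trace path)
      trace-image : List.map ψ (trace path) ≡ trace q

  pull : ∀ {m a d} → Within m (ψ a) → Ball a → (q : Path 𝒜 (ψ a) d m) → Lift a q
  pull {a = a} w ba [] = record
    { end = a ; path = [] ; end-ball = ba ; end-image = refl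
    ; trace-ball = [] ; trace-image = refl }
  pull w ba (e ∷ q) with ψ-surjective (within-ball (within-step w e))
  ... | a′ , ba′ , refl = record
    { end = end ; path = ψ-adj⁻¹ ba ba′ e ∷ path ; end-ball = end-ball ; end-image = end-image
    ; trace-ball = ba′ ∷ trace-ball ; trace-image = cong (_ List.∷_) trace-image }
    where open Lift (pull (within-step w e) ba′ q)

  short-paths-↔ : ∀ {x m} → Ball x → m ≤ r → Path 𝒜 0v x m ↔ Path 𝒜 0v (ψ x) m
  short-paths-↔ {x} {m} bx m≤r =
    subst (λ o → Path 𝒜 0v x m ↔ Path 𝒜 o (ψ x) m) ψ-zero (mk↔ₛ′ to from to∘from from∘to)
    where
    open ≡-Reasoning
    w₀ : Within m 0v
    w₀ = within-origin m≤r

    lift : (q : Path 𝒜 (ψ 0v) (ψ x) m) → Lift 0v q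
    lift = pull (subst (Within m) (sym ψ-zero) w₀) (within-ball w₀)

    lands-on-x : ∀ {q} (L : Lift 0v q) → Lift.end L ≡ x
    lands-on-x L = ψ-injective (Lift.end-ball L) bx (Lift.end-image L)

    to : Path 𝒜 0v x m → Path 𝒜 (ψ 0v) (ψ x) m
    to = push w₀

    from : Path 𝒜 (ψ 0v) (ψ x) m → Path 𝒜 0v x m
    from q = subst (λ z → Path 𝒜 0v z m) (lands-on-x (lift q)) (Lift.path (lift q))

    -- Both round trips are checked on traces, where ψ acts by List.map.
    trace-from : ∀ q → trace (from q) ≡ trace (Lift.path (lift q))
    trace-from q = trace-subst (lands-on-x (lift q)) _

    to∘from : ∀ q → to (from q) ≡ q
    to∘from q = trace-injective _ _ (begin
      trace (push w₀ (from q))                 ≡⟨ push-trace w₀ (from q) ⟩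
      List.map ψ (trace (from q))              ≡⟨ cong (List.map ψ) (trace-from q) ⟩
      List.map ψ (trace (Lift.path (lift q)))  ≡⟨ Lift.trace-image (lift q) ⟩
      trace q                                  ∎)

    from∘to : ∀ p → from (to p) ≡ p
    from∘to p = trace-injective _ _ (begin
      trace (from (to p))                      ≡⟨ trace-from (to p) ⟩
      trace (Lift.path (lift (to p)))          ≡⟨ map-injectiveOn ψ-injective
                                                    (Lift.trace-ball (lift (to p))) (within-trace w₀ p)
                                                    (trans (Lift.trace-image (lift (to p))) (push-trace w₀ p)) ⟩
      trace p                                  ∎)

  ρ≤r : ∀ {x n} → Ball x → ρ≡ 𝒜 x n → n ≤ r
  ρ≤r (_ , (p₀ , _) , n₀≤r) (_ , minimal) = ≤-trans (minimal _ p₀) n₀≤r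

  -- ρ(ψ x) = ρ(x): a path to ψ x shorter than ρ(x) ≤ r would pull back to x.
  ρ-preserved : ∀ {x n} → Ball x → ρ≡ 𝒜 x n → ρ≡ 𝒜 (ψ x) n
  ρ-preserved {x} {n} bx ρx@(geodesic , minimal) =
    to (short-paths-↔ bx n≤r) geodesic , shortest
    where
    open Inverse
    n≤r = ρ≤r bx ρx
    shortest : ∀ m → Path 𝒜 0v (ψ x) m → n ≤ m
    shortest m q with m ≤? r
    ... | yes m≤r = minimal m (from (short-paths-↔ bx m≤r) q)
    ... | no  m≰r = ≤-trans n≤r (<⇒≤ (≰⇒> m≰r))

  ω-preserved : ∀ {x c} → Ball x → ω≡ 𝒜 x c → ω≡ 𝒜 (ψ x) c
  ω-preserved bx (n , ρx , count) =
    n , ρ-preserved bx ρx , (short-paths-↔ bx (ρ≤r bx ρx) ↔-∘ count)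

proposition4 : ∀ {k : ℕ} → 1 ≤ k → (𝒜 : GenSet k) (r : ℕ) (φ : Vertex k → Vertex k)
    → IsBallIso 𝒜 r φ
    → ∀ x → InBall 𝒜 r x
    → (∀ n → ρ≡ 𝒜 x n → ρ≡ 𝒜 (φ x ⊖ φ 0v) n)
    × (∀ m → ω≡ 𝒜 x m → ω≡ 𝒜 (φ x ⊖ φ 0v) m)
proposition4 _ 𝒜 r φ iso x bx = (λ _ → ρ-preserved bx) , (λ _ → ω-preserved bx)
  where open Transport 𝒜 r φ iso
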